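{- Let $N$ be a fuzzy negation and let $D_\bot$ be the disjunctor $D_\bot(x,y)=1$ if $x=1$ or $y=1$, and $D_\bot(x,y)=0$ otherwise. Let $I(x,y)=D_\bot(N(x),y)$. Then there is no conjunctor $A$ such that $I$ satisfies (A5) with $A$.
   Context: A fuzzy negation is a non-increasing map $N:[0,1]\to[0,1]$ with $N(0)=1$, $N(1)=0$. A binary aggregation function is a map $A:[0,1]^2\to[0,1]$, non-decreasing in each variable, with $A(0,0)=0$, $A(1,1)=1$; it is a conjunctor if moreover $A(1,0)=A(0,1)=0$. A fuzzy set on a nonempty set $U$ is a map $D:U\to[0,1]$; it is normal if $D(x_0)=1$ for some $x_0\in U$. A map $I:[0,1]^2\to[0,1]$ satisfies (A5) with $A$ if for all nonempty sets $U,V$, all normal fuzzy sets $D$ on $U$ and $B$ on $V$, and all $y\in V$: $B(y)=\sup_{x\in U}A\big(D(x),I(D(x),B(y))\big)$. -}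

module Defs where

open import Level using (0ℓ)
open import Data.Product using (Σ; _×_; _,_; proj₁; proj₂)
open import Data.Sum using (_⊎_)
open import Relation.Nullary using (¬_)
open import Relation.Binary.PropositionalEquality using (_≡_)
open import Relation.Binary.Structures using (IsTotalOrder)
open import Algebra.Structures using (IsCommutativeRing)

-- The real numbers, axiomatised as a Dedekind-complete ordered field.
-- (agda-stdlib has no real numbers; we quantify over every model of these
-- axioms, all of which are isomorphic to ℝ.)
record RealField : Set₁ where
  infixl 6 _+_
  infixl 7 _*_
  infix  4 _≤_
  field
    Carrier : Set
    _+_ _*_ : Carrier → Carrier → Carrier
    -_      : Carrier → Carrier
    0# 1#   : Carrier
    _≤_     : Carrier → Carrier → Set
    isCommutativeRing : IsCommutativeRing _≡_ _+_ _*_ -_ 0# 1#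
    0≢1     : ¬ (0# ≡ 1#)
    0≤1     : 0# ≤ 1#   -- derivable, included for convenience
    inverse : ∀ x → ¬ (x ≡ 0#) → Σ Carrier (λ y → x * y ≡ 1#)
    isTotalOrder : IsTotalOrder _≡_ _≤_
    +-mono-≤ : ∀ {x y} z → x ≤ y → x + z ≤ y + z
    *-nonneg : ∀ {x y} → 0# ≤ x → 0# ≤ y → 0# ≤ x * y
    complete : (P : Carrier → Set) → Σ Carrier P →
               Σ Carrier (λ b → ∀ x → P x → x ≤ b) →
               Σ Carrier (λ s → (∀ x → P x → x ≤ s) ×
                                (∀ b → (∀ x → P x → x ≤ b) → s ≤ b))

module Fuzzy (ℝ : RealField) where
  open RealField ℝ

  𝕀 : Set
  𝕀 = Σ Carrier (λ x → (0# ≤ x) × (x ≤ 1#))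

  _≤ᵢ_ : 𝕀 → 𝕀 → Set
  a ≤ᵢ b = proj₁ a ≤ proj₁ b

  _≈ᵢ_ : 𝕀 → 𝕀 → Set
  a ≈ᵢ b = proj₁ a ≡ proj₁ b

  0ᵢ 1ᵢ : 𝕀
  0ᵢ = 0# , IsTotalOrder.refl isTotalOrder , 0≤1
  1ᵢ = 1# , 0≤1 , IsTotalOrder.refl isTotalOrder

  IsFuzzyNegation : (𝕀 → 𝕀) → Set
  IsFuzzyNegation N =
    (∀ x y → x ≤ᵢ y → N y ≤ᵢ N x) × (N 0ᵢ ≈ᵢ 1ᵢ) × (N 1ᵢ ≈ᵢ 0ᵢ)

  IsAggregation : (𝕀 → 𝕀 → 𝕀) → Set
  IsAggregation A =
    (∀ x₁ x₂ y → x₁ ≤ᵢ x₂ → A x₁ y ≤ᵢ A x₂ y) ×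
    (∀ x y₁ y₂ → y₁ ≤ᵢ y₂ → A x y₁ ≤ᵢ A x y₂) ×
    (A 0ᵢ 0ᵢ ≈ᵢ 0ᵢ) × (A 1ᵢ 1ᵢ ≈ᵢ 1ᵢ)

  IsConjunctor : (𝕀 → 𝕀 → 𝕀) → Set
  IsConjunctor A = IsAggregation A × (A 1ᵢ 0ᵢ ≈ᵢ 0ᵢ) × (A 0ᵢ 1ᵢ ≈ᵢ 0ᵢ)

  -- the drastic disjunctor D⊥: D⊥(x,y) = 1 if x = 1 or y = 1, and 0 otherwise
  -- (specified by its values, since equality of reals is not decidable in Agda)
  IsDrasticDisjunctor : (𝕀 → 𝕀 → 𝕀) → Set
  IsDrasticDisjunctor D =
    ∀ x y → (((x ≈ᵢ 1ᵢ) ⊎ (y ≈ᵢ 1ᵢ)) → D x y ≈ᵢ 1ᵢ) ×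
            (¬ ((x ≈ᵢ 1ᵢ) ⊎ (y ≈ᵢ 1ᵢ)) → D x y ≈ᵢ 0ᵢ)

  IsSup : {U : Set} → (U → 𝕀) → 𝕀 → Set
  IsSup {U} f s = (∀ u → f u ≤ᵢ s) × (∀ t → (∀ u → f u ≤ᵢ t) → s ≤ᵢ t)

  IsNormal : {U : Set} → (U → 𝕀) → Set
  IsNormal {U} D = Σ U (λ x₀ → D x₀ ≈ᵢ 1ᵢ)

  SatisfiesA5 : (𝕀 → 𝕀 → 𝕀) → (𝕀 → 𝕀 → 𝕀) → Set₁
  SatisfiesA5 I A =
    (U V : Set) → U → V → (D : U → 𝕀) → (B : V → 𝕀) →
    IsNormal D → IsNormal B → (y : V) →
    IsSup (λ x → A (D x) (I (D x) (B y))) (B y)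

-- If I satisfies (A5) with A then A(1, I(1, y)) = y for every y: take U a singleton with D = 1.
-- For I(x, y) = D⊥(N x, y) and y ≠ 1 we have I(1, y) = D⊥(0, y) = 0, so y = A(1, 0) = 0 for a
-- conjunctor A. Hence [0,1] would contain nothing but 0 and 1, which fails at y = 1/2.
module Submission where

open import Defs
open import Data.Product using (Σ; _×_; _,_; proj₁; proj₂)
open import Data.Sum using (inj₁; inj₂)
open import Data.Bool using (Bool; true; false)
open import Data.Unit using (tt)
open import Data.Empty using (⊥-elim)
open import Relation.Nullary using (¬_)
open import Relation.Binary.PropositionalEquality
open import Relation.Binary.Structures using (IsTotalOrder)
open import Algebra.Structures using (IsCommutativeRing)
open import Algebra.Bundles using (Group)
import Algebra.Properties.Group as GroupProperties

module OrderedFieldHalf (ℝ : RealField) where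
  open RealField ℝ
  open IsCommutativeRing isCommutativeRing
    using (+-isGroup; +-identityˡ; *-identityʳ; distribˡ; *-comm)
  open IsTotalOrder isTotalOrder using (antisym; total) renaming (trans to ≤-trans)

  +-group : Group _ _
  +-group = record { isGroup = +-isGroup }

  open GroupProperties +-group using (identityʳ-unique)

  1≢0 : ¬ (1# ≡ 0#)
  1≢0 e = 0≢1 (sym e)

  x≤0⇒x+x≤0 : ∀ {x} → x ≤ 0# → x + x ≤ 0#
  x≤0⇒x+x≤0 {x} x≤0 = ≤-trans (subst (x + x ≤_) (+-identityˡ x) (+-mono-≤ x x≤0)) x≤0

  2≢0 : ¬ (1# + 1# ≡ 0#)
  2≢0 e = 1≢0 (antisym 1≤0 0≤1)
    where
    1≤0 : 1# ≤ 0#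
    1≤0 = subst₂ _≤_ (+-identityˡ 1#) e (+-mono-≤ 1# 0≤1)

  ½ : Carrier
  ½ = proj₁ (inverse (1# + 1#) 2≢0)

  ½+½≡1 : ½ + ½ ≡ 1#
  ½+½≡1 = begin
    ½ + ½             ≡⟨ cong₂ _+_ (sym (*-identityʳ ½)) (sym (*-identityʳ ½)) ⟩
    ½ * 1# + ½ * 1#   ≡⟨ sym (distribˡ ½ 1# 1#) ⟩
    ½ * (1# + 1#)     ≡⟨ *-comm ½ (1# + 1#) ⟩
    (1# + 1#) * ½     ≡⟨ proj₂ (inverse (1# + 1#) 2≢0) ⟩
    1#                ∎
    where open ≡-Reasoning

  ½≢0 : ¬ (½ ≡ 0#)
  ½≢0 e = 1≢0 (trans (sym ½+½≡1) (trans (cong₂ _+_ e e) (+-identityˡ 0#)))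

  ½≢1 : ¬ (½ ≡ 1#)
  ½≢1 e = 1≢0 (identityʳ-unique 1# 1# (trans (cong₂ _+_ (sym e) (sym e)) ½+½≡1))

  0≤½ : 0# ≤ ½
  0≤½ with total 0# ½
  ... | inj₁ 0≤½ = 0≤½
  ... | inj₂ ½≤0 = ⊥-elim (1≢0 (antisym (subst (_≤ 0#) ½+½≡1 (x≤0⇒x+x≤0 ½≤0)) 0≤1))

  ½≤1 : ½ ≤ 1#
  ½≤1 = subst₂ _≤_ (+-identityˡ ½) ½+½≡1 (+-mono-≤ ½ 0≤½)

module FuzzyLemmas (ℝ : RealField) where
  open RealField ℝ
  open Fuzzy ℝ
  open IsTotalOrder isTotalOrder using (antisym) renaming (refl to ≤-refl)

  A5⇒A-1-I-1≈id : ∀ {I A} → SatisfiesA5 I A → ∀ y → A 1ᵢ (I 1ᵢ y) ≈ᵢ y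
  A5⇒A-1-I-1≈id {I} {A} a5 y =
    antisym (proj₁ sup tt) (proj₂ sup (A 1ᵢ (I 1ᵢ y)) (λ _ → ≤-refl))
    where
    B : Bool → 𝕀
    B true  = 1ᵢ
    B false = y

    sup : IsSup (λ _ → A 1ᵢ (I 1ᵢ y)) y
    sup = a5 _ Bool tt true (λ _ → 1ᵢ) B (tt , refl) (true , refl) false

  drastic-off-1 : ∀ {D x y} → IsDrasticDisjunctor D →
                  ¬ (x ≈ᵢ 1ᵢ) → ¬ (y ≈ᵢ 1ᵢ) → D x y ≈ᵢ 0ᵢ
  drastic-off-1 {x = x} {y} isD x≉1 y≉1 = proj₂ (isD x y) λ where
    (inj₁ x≈1) → x≉1 x≈1
    (inj₂ y≈1) → y≉1 y≈1

proposition4p10 : (ℝ : RealField) → let open Fuzzy ℝ in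
    (N : 𝕀 → 𝕀) → IsFuzzyNegation N →
    (D⊥ : 𝕀 → 𝕀 → 𝕀) → IsDrasticDisjunctor D⊥ →
    ¬ (Σ (𝕀 → 𝕀 → 𝕀) (λ A →
    IsConjunctor A × SatisfiesA5 (λ x y → D⊥ (N x) y) A))
proposition4p10 ℝ N (_ , _ , N1≈0) D⊥ isD⊥ (A , ((_ , A-mono₂ , _) , A10≈0 , _) , a5) =
  ½≢0 (antisym ½≤0 0≤½)
  where
  open RealField ℝ
  open Fuzzy ℝ
  open IsTotalOrder isTotalOrder using (antisym; reflexive) renaming (trans to ≤-trans)
  open OrderedFieldHalf ℝ
  open FuzzyLemmas ℝ

  ½ᵢ : 𝕀
  ½ᵢ = ½ , 0≤½ , ½≤1

  I-1-½≤0 : D⊥ (N 1ᵢ) ½ᵢ ≤ᵢ 0ᵢ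
  I-1-½≤0 = reflexive (drastic-off-1 {D⊥} isD⊥ (λ N1≈1 → 0≢1 (trans (sym N1≈0) N1≈1)) ½≢1)

  -- A is only known to be monotone, not to respect ≈ᵢ, so I(1, ½) ≈ᵢ 0 enters through A-mono₂.
  ½≤0 : ½ ≤ 0#
  ½≤0 = ≤-trans (reflexive (sym (A5⇒A-1-I-1≈id {λ x y → D⊥ (N x) y} {A} a5 ½ᵢ)))
          (≤-trans (A-mono₂ 1ᵢ _ 0ᵢ I-1-½≤0) (reflexive A10≈0))
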